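{- Let $\mathcal{E}$ be a locally cartesian closed model of guarded recursive terms. For every morphism $u:J\to I$ in $\mathcal{E}$ the functors $u^*\circ\blacktriangleright_I$ and $\blacktriangleright_J\circ u^*$ from $\mathcal{E}/I$ to $\mathcal{E}/J$ are isomorphic. As a consequence, the family $(\blacktriangleright_I)_{I\in\mathcal{E}}$ defines a fibred endofunctor on the codomain fibration of $\mathcal{E}$.
   Context: A model of guarded recursive terms is a category $\mathcal{E}$ with finite products, an endofunctor $\blacktriangleright$ preserving finite limits and a natural transformation $\mathrm{next}:\mathrm{id}\to\blacktriangleright$ such that every $f:\blacktriangleright X\to X$ has a unique $h:1\to X$ with $f\circ\mathrm{next}\circ h=h$. On $\mathcal{E}/I$, $\blacktriangleright_I(p_X:X\to I)$ is the pullback of $\blacktriangleright p_X:\blacktriangleright X\to\blacktriangleright I$ along $\mathrm{next}_I:I\to\blacktriangleright I$. $u^*$ denotes pullback along $u$. -}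

module Defs where

open import Level using (Level; _⊔_) renaming (suc to lsuc)
open import Data.Product using (Σ; _×_; _,_; proj₁; proj₂; Σ-syntax)
open import Relation.Binary using (IsEquivalence; Rel)

record Category (o ℓ e : Level) : Set (lsuc (o ⊔ ℓ ⊔ e)) where
  infix  4 _≈_
  infixr 9 _∘_
  field
    Obj : Set o
    _⇒_ : Obj → Obj → Set ℓ
    _≈_ : ∀ {A B} → Rel (A ⇒ B) e
    id  : ∀ {A} → A ⇒ A
    _∘_ : ∀ {A B C} → B ⇒ C → A ⇒ B → A ⇒ C
    assoc     : ∀ {A B C D} {f : A ⇒ B} {g : B ⇒ C} {h : C ⇒ D} →
                (h ∘ g) ∘ f ≈ h ∘ (g ∘ f)
    identityˡ : ∀ {A B} {f : A ⇒ B} → id ∘ f ≈ f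
    identityʳ : ∀ {A B} {f : A ⇒ B} → f ∘ id ≈ f
    equiv     : ∀ {A B} → IsEquivalence (_≈_ {A} {B})
    ∘-resp-≈  : ∀ {A B C} {f h : B ⇒ C} {g i : A ⇒ B} →
                f ≈ h → g ≈ i → f ∘ g ≈ h ∘ i

  ≈-refl : ∀ {A B} {f : A ⇒ B} → f ≈ f
  ≈-refl = IsEquivalence.refl equiv
  ≈-sym : ∀ {A B} {f g : A ⇒ B} → f ≈ g → g ≈ f
  ≈-sym = IsEquivalence.sym equiv
  ≈-trans : ∀ {A B} {f g h : A ⇒ B} → f ≈ g → g ≈ h → f ≈ h
  ≈-trans = IsEquivalence.trans equiv
  assoc˘ : ∀ {A B C D} {f : A ⇒ B} {g : B ⇒ C} {h : C ⇒ D} →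
           h ∘ (g ∘ f) ≈ (h ∘ g) ∘ f
  assoc˘ = ≈-sym assoc

record Functor {o ℓ e o′ ℓ′ e′} (C : Category o ℓ e) (D : Category o′ ℓ′ e′)
       : Set (o ⊔ ℓ ⊔ e ⊔ o′ ⊔ ℓ′ ⊔ e′) where
  private
    module C = Category C
    module D = Category D
  field
    F₀ : C.Obj → D.Obj
    F₁ : ∀ {A B} → A C.⇒ B → F₀ A D.⇒ F₀ B
    identity     : ∀ {A} → F₁ (C.id {A}) D.≈ D.id
    homomorphism : ∀ {A B C'} {f : A C.⇒ B} {g : B C.⇒ C'} →
                   F₁ (g C.∘ f) D.≈ F₁ g D.∘ F₁ f
    F-resp-≈     : ∀ {A B} {f g : A C.⇒ B} → f C.≈ g → F₁ f D.≈ F₁ g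

-- the action of a functor on objects and morphisms (no laws); used for
-- functors that are constructed from chosen pullbacks
record FunctorData {o ℓ e o′ ℓ′ e′} (C : Category o ℓ e) (D : Category o′ ℓ′ e′)
       : Set (o ⊔ ℓ ⊔ o′ ⊔ ℓ′) where
  private
    module C = Category C
    module D = Category D
  field
    F₀ : C.Obj → D.Obj
    F₁ : ∀ {A B} → A C.⇒ B → F₀ A D.⇒ F₀ B

_∘F_ : ∀ {o ℓ e o′ ℓ′ e′ o″ ℓ″ e″} {C : Category o ℓ e} {D : Category o′ ℓ′ e′}
         {E : Category o″ ℓ″ e″} → FunctorData D E → FunctorData C D → FunctorData C E
G ∘F F = record { F₀ = λ X → FunctorData.F₀ G (FunctorData.F₀ F X)
                ; F₁ = λ f → FunctorData.F₁ G (FunctorData.F₁ F f) }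

record NaturalIsomorphism {o ℓ e o′ ℓ′ e′} {C : Category o ℓ e} {D : Category o′ ℓ′ e′}
       (F G : FunctorData C D) : Set (o ⊔ ℓ ⊔ o′ ⊔ ℓ′ ⊔ e′) where
  private
    module C = Category C
    module D = Category D
    module F = FunctorData F
    module G = FunctorData G
  field
    η   : ∀ X → F.F₀ X D.⇒ G.F₀ X
    η⁻¹ : ∀ X → G.F₀ X D.⇒ F.F₀ X
    isoˡ : ∀ X → η⁻¹ X D.∘ η X D.≈ D.id
    isoʳ : ∀ X → η X D.∘ η⁻¹ X D.≈ D.id
    natural : ∀ {X Y} (f : X C.⇒ Y) → G.F₁ f D.∘ η X D.≈ η Y D.∘ F.F₁ f

module _ {o ℓ e} (C : Category o ℓ e) where
  open Category C

  IsTerminal : Obj → Set (o ⊔ ℓ ⊔ e)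
  IsTerminal T = ∀ X → Σ[ ! ∈ X ⇒ T ] (∀ (g : X ⇒ T) → g ≈ !)

  record IsProduct {A B P : Obj} (π₁ : P ⇒ A) (π₂ : P ⇒ B) : Set (o ⊔ ℓ ⊔ e) where
    field
      ⟨_,_⟩    : ∀ {Z} → Z ⇒ A → Z ⇒ B → Z ⇒ P
      project₁ : ∀ {Z} {h₁ : Z ⇒ A} {h₂ : Z ⇒ B} → π₁ ∘ ⟨ h₁ , h₂ ⟩ ≈ h₁
      project₂ : ∀ {Z} {h₁ : Z ⇒ A} {h₂ : Z ⇒ B} → π₂ ∘ ⟨ h₁ , h₂ ⟩ ≈ h₂
      unique   : ∀ {Z} {h₁ : Z ⇒ A} {h₂ : Z ⇒ B} {k : Z ⇒ P} →
                 π₁ ∘ k ≈ h₁ → π₂ ∘ k ≈ h₂ → k ≈ ⟨ h₁ , h₂ ⟩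

  record Product (A B : Obj) : Set (o ⊔ ℓ ⊔ e) where
    field
      A×B : Obj
      π₁  : A×B ⇒ A
      π₂  : A×B ⇒ B
      isProduct : IsProduct π₁ π₂

  record IsPullback {A B C' P : Obj} (f : A ⇒ C') (g : B ⇒ C')
         (p₁ : P ⇒ A) (p₂ : P ⇒ B) : Set (o ⊔ ℓ ⊔ e) where
    field
      commute   : f ∘ p₁ ≈ g ∘ p₂
      universal : ∀ {Z} {h₁ : Z ⇒ A} {h₂ : Z ⇒ B} → f ∘ h₁ ≈ g ∘ h₂ → Z ⇒ P
      p₁∘universal : ∀ {Z} {h₁ : Z ⇒ A} {h₂ : Z ⇒ B} (eq : f ∘ h₁ ≈ g ∘ h₂) →
                     p₁ ∘ universal eq ≈ h₁
      p₂∘universal : ∀ {Z} {h₁ : Z ⇒ A} {h₂ : Z ⇒ B} (eq : f ∘ h₁ ≈ g ∘ h₂) →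
                     p₂ ∘ universal eq ≈ h₂
      unique : ∀ {Z} {h₁ : Z ⇒ A} {h₂ : Z ⇒ B} (eq : f ∘ h₁ ≈ g ∘ h₂) {k : Z ⇒ P} →
               p₁ ∘ k ≈ h₁ → p₂ ∘ k ≈ h₂ → k ≈ universal eq

  record Pullback {A B C' : Obj} (f : A ⇒ C') (g : B ⇒ C') : Set (o ⊔ ℓ ⊔ e) where
    field
      P  : Obj
      p₁ : P ⇒ A
      p₂ : P ⇒ B
      isPullback : IsPullback f g p₁ p₂
    open IsPullback isPullback public

  HasPullbacks : Set (o ⊔ ℓ ⊔ e)
  HasPullbacks = ∀ {A B C' : Obj} (f : A ⇒ C') (g : B ⇒ C') → Pullback f g

  record FiniteProducts : Set (o ⊔ ℓ ⊔ e) where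
    field
      ⊤ : Obj
      ⊤-isTerminal : IsTerminal ⊤
      product : ∀ A B → Product A B

module _ {o ℓ e} {C : Category o ℓ e} where
  open Category C

  -- F preserves finite limits: it preserves terminal objects and pullback
  -- squares (all finite limits are built from these)
  record PreservesFiniteLimits (F : Functor C C) : Set (o ⊔ ℓ ⊔ e) where
    open Functor F
    field
      preserves-terminal : ∀ {T} → IsTerminal C T → IsTerminal C (F₀ T)
      preserves-pullback : ∀ {A B C' P} {f : A ⇒ C'} {g : B ⇒ C'}
                             {p₁ : P ⇒ A} {p₂ : P ⇒ B} →
                           IsPullback C f g p₁ p₂ →
                           IsPullback C (F₁ f) (F₁ g) (F₁ p₁) (F₁ p₂)

  record NatTransFromId (F : Functor C C) : Set (o ⊔ ℓ ⊔ e) where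
    open Functor F
    field
      η : ∀ X → X ⇒ F₀ X
      commute : ∀ {X Y} (f : X ⇒ Y) → F₁ f ∘ η X ≈ η Y ∘ f

record ModelOfGuardedRecursiveTerms {o ℓ e} (C : Category o ℓ e) : Set (o ⊔ ℓ ⊔ e) where
  open Category C
  field
    finiteProducts : FiniteProducts C
    ▶    : Functor C C
    ▶-lex : PreservesFiniteLimits ▶
    next : NatTransFromId ▶
  open FiniteProducts finiteProducts using (⊤)
  open Functor ▶ using () renaming (F₀ to ▶₀)
  open NatTransFromId next using () renaming (η to next₀)
  field
    fixpoint        : ∀ {X} (f : ▶₀ X ⇒ X) → ⊤ ⇒ X
    fixpoint-eq     : ∀ {X} (f : ▶₀ X ⇒ X) → f ∘ (next₀ X ∘ fixpoint f) ≈ fixpoint f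
    fixpoint-unique : ∀ {X} (f : ▶₀ X ⇒ X) (h : ⊤ ⇒ X) →
                      f ∘ (next₀ X ∘ h) ≈ h → h ≈ fixpoint f

module _ {o ℓ e} (C : Category o ℓ e) where
  open Category C

  record SliceObj (I : Obj) : Set (o ⊔ ℓ) where
    constructor sliceobj
    field
      {dom} : Obj
      arr   : dom ⇒ I

  record SliceHom {I : Obj} (X Y : SliceObj I) : Set (ℓ ⊔ e) where
    constructor slicehom
    private
      module X = SliceObj X
      module Y = SliceObj Y
    field
      h : X.dom ⇒ Y.dom
      △ : Y.arr ∘ h ≈ X.arr

  Slice : Obj → Category (o ⊔ ℓ) (ℓ ⊔ e) e
  Slice I = record
    { Obj = SliceObj I
    ; _⇒_ = SliceHom
    ; _≈_ = λ f g → SliceHom.h f ≈ SliceHom.h g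
    ; id  = slicehom id identityʳ
    ; _∘_ = λ {X} {Y} {Z} g f → slicehom (SliceHom.h g ∘ SliceHom.h f)
              (≈-trans assoc˘ (≈-trans (∘-resp-≈ (SliceHom.△ g) ≈-refl) (SliceHom.△ f)))
    ; assoc = assoc
    ; identityˡ = identityˡ
    ; identityʳ = identityʳ
    ; equiv = record { refl = ≈-refl ; sym = ≈-sym ; trans = ≈-trans }
    ; ∘-resp-≈ = ∘-resp-≈
    }

module PullbackFunctor {o ℓ e} (C : Category o ℓ e) (pb : HasPullbacks C) where
  open Category C

  _* : ∀ {J I} (u : J ⇒ I) → FunctorData (Slice C I) (Slice C J)
  _* {J} {I} u = record { F₀ = F₀ ; F₁ = F₁ }
    where
    F₀ : SliceObj C I → SliceObj C J
    F₀ X = sliceobj (Pullback.p₁ (pb u (SliceObj.arr X)))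
    F₁ : ∀ {X Y} → SliceHom C X Y → SliceHom C (F₀ X) (F₀ Y)
    F₁ {X} {Y} f = slicehom (PY.universal eq) (PY.p₁∘universal eq)
      where
      module PX = Pullback (pb u (SliceObj.arr X))
      module PY = Pullback (pb u (SliceObj.arr Y))
      eq : u ∘ PX.p₁ ≈ SliceObj.arr Y ∘ (SliceHom.h f ∘ PX.p₂)
      eq = ≈-trans PX.commute
             (≈-trans (∘-resp-≈ (≈-sym (SliceHom.△ f)) ≈-refl) assoc)

-- Locally cartesian closed categories: finite limits, and every pullback
-- functor u* has a right adjoint Π_u (given by its universal property)

record LocallyCartesianClosed {o ℓ e} (C : Category o ℓ e) : Set (o ⊔ ℓ ⊔ e) where
  open Category C
  field
    ⊤ : Obj
    ⊤-isTerminal : IsTerminal C ⊤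
    pullbacks : HasPullbacks C
  open PullbackFunctor C pullbacks
  private
    module S (I : Obj) = Category (Slice C I)
  field
    Π   : ∀ {J I} (u : J ⇒ I) → SliceObj C J → SliceObj C I
    ε   : ∀ {J I} (u : J ⇒ I) (Y : SliceObj C J) →
          SliceHom C (FunctorData.F₀ (u *) (Π u Y)) Y
    Π-universal : ∀ {J I} (u : J ⇒ I) (Y : SliceObj C J) (X : SliceObj C I) →
                  SliceHom C (FunctorData.F₀ (u *) X) Y → SliceHom C X (Π u Y)
    Π-commute   : ∀ {J I} (u : J ⇒ I) (Y : SliceObj C J) (X : SliceObj C I)
                  (g : SliceHom C (FunctorData.F₀ (u *) X) Y) →
                  S._≈_ J (S._∘_ J (ε u Y) (FunctorData.F₁ (u *) (Π-universal u Y X g))) g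
    Π-unique    : ∀ {J I} (u : J ⇒ I) (Y : SliceObj C J) (X : SliceObj C I)
                  (g : SliceHom C (FunctorData.F₀ (u *) X) Y) (k : SliceHom C X (Π u Y)) →
                  S._≈_ J (S._∘_ J (ε u Y) (FunctorData.F₁ (u *) k)) g →
                  S._≈_ I k (Π-universal u Y X g)

module LaterSlices {o ℓ e} {C : Category o ℓ e} (pb : HasPullbacks C)
       (▶ : Functor C C) (next : NatTransFromId ▶) where
  open Category C
  open Functor ▶ renaming (F₀ to ▶₀; F₁ to ▶₁)
  open NatTransFromId next renaming (η to next₀; commute to next-commute)

  ▶[_] : ∀ I → FunctorData (Slice C I) (Slice C I)
  ▶[ I ] = record { F₀ = F₀ ; F₁ = F₁ }
    where
    F₀ : SliceObj C I → SliceObj C I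
    F₀ X = sliceobj (Pullback.p₁ (pb (next₀ I) (▶₁ (SliceObj.arr X))))
    F₁ : ∀ {X Y} → SliceHom C X Y → SliceHom C (F₀ X) (F₀ Y)
    F₁ {X} {Y} f = slicehom (PY.universal eq) (PY.p₁∘universal eq)
      where
      module PX = Pullback (pb (next₀ I) (▶₁ (SliceObj.arr X)))
      module PY = Pullback (pb (next₀ I) (▶₁ (SliceObj.arr Y)))
      eq : next₀ I ∘ PX.p₁ ≈ ▶₁ (SliceObj.arr Y) ∘ (▶₁ (SliceHom.h f) ∘ PX.p₂)
      eq = ≈-trans PX.commute
             (≈-trans (∘-resp-≈ (≈-trans (F-resp-≈ (≈-sym (SliceHom.△ f))) homomorphism)
                                ≈-refl)
                      assoc)

  -- the arrow category C^→ (the total category of the codomain fibration)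
  record ArrObj : Set (o ⊔ ℓ) where
    constructor arrobj
    field
      {dom cod} : Obj
      arr : dom ⇒ cod

  record ArrHom (X Y : ArrObj) : Set (ℓ ⊔ e) where
    constructor arrhom
    private
      module X = ArrObj X
      module Y = ArrObj Y
    field
      top : X.dom ⇒ Y.dom
      bot : X.cod ⇒ Y.cod
      sq  : Y.arr ∘ top ≈ bot ∘ X.arr

  _≈→_ : ∀ {X Y} → ArrHom X Y → ArrHom X Y → Set e
  f ≈→ g = (ArrHom.top f ≈ ArrHom.top g) × (ArrHom.bot f ≈ ArrHom.bot g)

  id→ : ∀ {X} → ArrHom X X
  id→ = arrhom id id (≈-trans identityʳ (≈-sym identityˡ))

  _∘→_ : ∀ {X Y Z} → ArrHom Y Z → ArrHom X Y → ArrHom X Z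
  _∘→_ {X} {Y} {Z} g f =
    arrhom (ArrHom.top g ∘ ArrHom.top f) (ArrHom.bot g ∘ ArrHom.bot f)
      (≈-trans assoc˘ (≈-trans (∘-resp-≈ (ArrHom.sq g) ≈-refl)
        (≈-trans assoc (≈-trans (∘-resp-≈ ≈-refl (ArrHom.sq f)) assoc˘))))

  -- cartesian morphisms of the codomain fibration = pullback squares
  IsCartesian : ∀ {X Y} → ArrHom X Y → Set (o ⊔ ℓ ⊔ e)
  IsCartesian {X} {Y} f = IsPullback C (ArrHom.bot f) (ArrObj.arr Y) (ArrObj.arr X) (ArrHom.top f)

  -- the functor C^→ → C^→ over C whose fibre over I is ▶_I
  ▶→₀ : ArrObj → ArrObj
  ▶→₀ X = arrobj (Pullback.p₁ (pb (next₀ (ArrObj.cod X)) (▶₁ (ArrObj.arr X))))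

  ▶→₁ : ∀ {X Y} → ArrHom X Y → ArrHom (▶→₀ X) (▶→₀ Y)
  ▶→₁ {X} {Y} f = arrhom (PY.universal eq) u (PY.p₁∘universal eq)
    where
    u = ArrHom.bot f
    module PX = Pullback (pb (next₀ (ArrObj.cod X)) (▶₁ (ArrObj.arr X)))
    module PY = Pullback (pb (next₀ (ArrObj.cod Y)) (▶₁ (ArrObj.arr Y)))
    eq : next₀ (ArrObj.cod Y) ∘ (u ∘ PX.p₁) ≈ ▶₁ (ArrObj.arr Y) ∘ (▶₁ (ArrHom.top f) ∘ PX.p₂)
    eq = ≈-trans assoc˘
         (≈-trans (∘-resp-≈ (≈-sym (next-commute u)) ≈-refl)
         (≈-trans assoc
         (≈-trans (∘-resp-≈ ≈-refl PX.commute)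
         (≈-trans assoc˘
         (≈-trans (∘-resp-≈ (≈-sym homomorphism) ≈-refl)
         (≈-trans (∘-resp-≈ (F-resp-≈ (≈-sym (ArrHom.sq f))) ≈-refl)
         (≈-trans (∘-resp-≈ homomorphism ≈-refl) assoc)))))))

  -- ▶→ is a fibred endofunctor of the codomain fibration: a functor
  -- (it lies over C by construction: bot (▶→₁ f) = bot f) which
  -- preserves cartesian morphisms
  record IsFibredEndofunctor : Set (o ⊔ ℓ ⊔ e) where
    field
      identity     : ∀ {X} → ▶→₁ (id→ {X}) ≈→ id→
      homomorphism : ∀ {X Y Z} {f : ArrHom X Y} {g : ArrHom Y Z} →
                     ▶→₁ (g ∘→ f) ≈→ (▶→₁ g ∘→ ▶→₁ f)
      F-resp-≈     : ∀ {X Y} {f g : ArrHom X Y} → f ≈→ g → ▶→₁ f ≈→ ▶→₁ g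
      preserves-cartesian : ∀ {X Y} (f : ArrHom X Y) → IsCartesian f → IsCartesian (▶→₁ f)

module Submission where

-- Everything rests on one observation: the functor ▶→ on arrows, whose
-- fibre over I is ▶_I, sends pullback squares to pullback squares.  For a
-- pullback square over u : J → I, pasting the pullback ▶_J X with the
-- ▶-image of the square (a pullback, ▶ being lex) and using naturality
-- ▶u ∘ next_J = next_I ∘ u, then unpasting the pullback defining ▶_I Y,
-- shows that the induced square ▶_J X → ▶_I Y is again a pullback.
--
-- Applied
-- to the cartesian square u*Y → Y, this makes ▶_J(u*Y) and u*(▶_I Y) two
-- pullbacks of the same cospan, whence the natural isomorphism.

open import Defs
open import Data.Product using (_×_; _,_; proj₁)
open import Relation.Binary.Bundles using (Setoid)
import Relation.Binary.Reasoning.Setoid as SetoidReasoning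

module PullbackLemmas {o ℓ e} (C : Category o ℓ e) where
  open Category C

  hom-setoid : Obj → Obj → Setoid ℓ e
  hom-setoid A B = record { Carrier = A ⇒ B ; _≈_ = _≈_ ; isEquivalence = equiv }

  open module HomReasoning {A B} = SetoidReasoning (hom-setoid A B) public

  ∘-resp-≈ˡ : ∀ {A B D} {a b : B ⇒ D} {c : A ⇒ B} → a ≈ b → a ∘ c ≈ b ∘ c
  ∘-resp-≈ˡ p = ∘-resp-≈ p ≈-refl

  ∘-resp-≈ʳ : ∀ {A B D} {a : B ⇒ D} {c d : A ⇒ B} → c ≈ d → a ∘ c ≈ a ∘ d
  ∘-resp-≈ʳ p = ∘-resp-≈ ≈-refl p

  pullˡ : ∀ {A B D E} {a : D ⇒ E} {b : B ⇒ D} {c : B ⇒ E} {d : A ⇒ B} →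
          a ∘ b ≈ c → a ∘ (b ∘ d) ≈ c ∘ d
  pullˡ p = ≈-trans assoc˘ (∘-resp-≈ˡ p)

  module _ {A B D P} {f : A ⇒ D} {g : B ⇒ D} {p₁ : P ⇒ A} {p₂ : P ⇒ B}
           (isP : IsPullback C f g p₁ p₂) where
    open IsPullback isP

    pullback-ext : ∀ {Z} {k k′ : Z ⇒ P} → p₁ ∘ k ≈ p₁ ∘ k′ → p₂ ∘ k ≈ p₂ ∘ k′ → k ≈ k′
    pullback-ext {k = k} e₁ e₂ =
      ≈-trans (unique square ≈-refl ≈-refl) (≈-sym (unique square (≈-sym e₁) (≈-sym e₂)))
      where
      square : f ∘ (p₁ ∘ k) ≈ g ∘ (p₂ ∘ k)
      square = ≈-trans (pullˡ commute) assoc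

    pullback-resp-≈ : ∀ {f′ : A ⇒ D} {p₂′ : P ⇒ B} → f ≈ f′ → p₂ ≈ p₂′ →
                      IsPullback C f′ g p₁ p₂′
    pullback-resp-≈ {f′} {p₂′} f≈f′ p₂≈p₂′ = record
      { commute = ≈-trans (∘-resp-≈ˡ (≈-sym f≈f′)) (≈-trans commute (∘-resp-≈ʳ p₂≈p₂′))
      ; universal = λ eq → universal (along eq)
      ; p₁∘universal = λ eq → p₁∘universal (along eq)
      ; p₂∘universal = λ eq →
          ≈-trans (∘-resp-≈ˡ (≈-sym p₂≈p₂′)) (p₂∘universal (along eq))
      ; unique = λ eq e₁ e₂ → unique (along eq) e₁ (≈-trans (∘-resp-≈ˡ p₂≈p₂′) e₂)
      }
      where
      along : ∀ {Z} {h₁ : Z ⇒ A} {h₂ : Z ⇒ B} → f′ ∘ h₁ ≈ g ∘ h₂ → f ∘ h₁ ≈ g ∘ h₂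
      along eq = ≈-trans (∘-resp-≈ˡ f≈f′) eq

  -- In the diagram
  --       P --p₂--> B --q₂--> D
  --       |p₁       |q₁       |h
  --       A --f---> X --g---> E
  -- with the right square a pullback, the left square is a pullback iff
  -- the outer rectangle is.
  module Pasting {A B X D E P} {f : A ⇒ X} {g : X ⇒ E} {h : D ⇒ E}
                 {q₁ : B ⇒ X} {q₂ : B ⇒ D} {p₁ : P ⇒ A} {p₂ : P ⇒ B}
                 (right : IsPullback C g h q₁ q₂) where
    private module R = IsPullback right

    outer-commutes : f ∘ p₁ ≈ q₁ ∘ p₂ → (g ∘ f) ∘ p₁ ≈ h ∘ (q₂ ∘ p₂)
    outer-commutes left = begin
      (g ∘ f) ∘ p₁   ≈⟨ assoc ⟩
      g ∘ (f ∘ p₁)   ≈⟨ ∘-resp-≈ʳ left ⟩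
      g ∘ (q₁ ∘ p₂)  ≈⟨ pullˡ R.commute ⟩
      (h ∘ q₂) ∘ p₂  ≈⟨ assoc ⟩
      h ∘ (q₂ ∘ p₂)  ∎

    paste : IsPullback C f q₁ p₁ p₂ → IsPullback C (g ∘ f) h p₁ (q₂ ∘ p₂)
    paste left = record
      { commute = outer-commutes L.commute
      ; universal = λ eq → L.universal (via eq)
      ; p₁∘universal = λ eq → L.p₁∘universal (via eq)
      ; p₂∘universal = λ eq →
          ≈-trans assoc (≈-trans (∘-resp-≈ʳ (L.p₂∘universal (via eq)))
                                 (R.p₂∘universal (assoc˘′ eq)))
      ; unique = λ eq e₁ e₂ → L.unique (via eq) e₁
          (R.unique (assoc˘′ eq)
            (≈-trans (pullˡ (≈-sym L.commute)) (≈-trans assoc (∘-resp-≈ʳ e₁)))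
            (≈-trans assoc˘ e₂))
      }
      where
      module L = IsPullback left
      assoc˘′ : ∀ {Z} {h₁ : Z ⇒ A} {h₂ : Z ⇒ D} →
                (g ∘ f) ∘ h₁ ≈ h ∘ h₂ → g ∘ (f ∘ h₁) ≈ h ∘ h₂
      assoc˘′ eq = ≈-trans assoc˘ eq
      via : ∀ {Z} {h₁ : Z ⇒ A} {h₂ : Z ⇒ D} (eq : (g ∘ f) ∘ h₁ ≈ h ∘ h₂) →
            f ∘ h₁ ≈ q₁ ∘ R.universal (assoc˘′ eq)
      via eq = ≈-sym (R.p₁∘universal (assoc˘′ eq))

    unpaste : IsPullback C (g ∘ f) h p₁ (q₂ ∘ p₂) → f ∘ p₁ ≈ q₁ ∘ p₂ →
              IsPullback C f q₁ p₁ p₂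
    unpaste outer left = record
      { commute = left
      ; universal = λ eq → O.universal (lift eq)
      ; p₁∘universal = λ eq → O.p₁∘universal (lift eq)
      ; p₂∘universal = p₂∘universal
      ; unique = λ eq e₁ e₂ → O.unique (lift eq) e₁ (≈-trans assoc (∘-resp-≈ʳ e₂))
      }
      where
      module O = IsPullback outer
      lift : ∀ {Z} {h₁ : Z ⇒ A} {h₂ : Z ⇒ B} →
             f ∘ h₁ ≈ q₁ ∘ h₂ → (g ∘ f) ∘ h₁ ≈ h ∘ (q₂ ∘ h₂)
      lift eq = ≈-trans assoc (≈-trans (∘-resp-≈ʳ eq) (≈-trans (pullˡ R.commute) assoc))
      p₂∘universal : ∀ {Z} {h₁ : Z ⇒ A} {h₂ : Z ⇒ B} (eq : f ∘ h₁ ≈ q₁ ∘ h₂) →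
                     p₂ ∘ O.universal (lift eq) ≈ h₂
      p₂∘universal {h₁ = h₁} {h₂} eq = pullback-ext right
        (begin
          q₁ ∘ (p₂ ∘ O.universal (lift eq))  ≈⟨ pullˡ (≈-sym left) ⟩
          (f ∘ p₁) ∘ O.universal (lift eq)   ≈⟨ assoc ⟩
          f ∘ (p₁ ∘ O.universal (lift eq))   ≈⟨ ∘-resp-≈ʳ (O.p₁∘universal (lift eq)) ⟩
          f ∘ h₁                             ≈⟨ eq ⟩
          q₁ ∘ h₂                            ∎)
        (≈-trans assoc˘ (O.p₂∘universal (lift eq)))

  comparison-inverse :
    ∀ {A B D P Q} {f : A ⇒ D} {g : B ⇒ D} {p₁ : P ⇒ A} {p₂ : P ⇒ B}
      {q₁ : Q ⇒ A} {q₂ : Q ⇒ B}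
      (isP : IsPullback C f g p₁ p₂) (isQ : IsPullback C f g q₁ q₂) →
    IsPullback.universal isQ (IsPullback.commute isP)
      ∘ IsPullback.universal isP (IsPullback.commute isQ) ≈ id
  comparison-inverse isP isQ = pullback-ext isQ
    (≈-trans (pullˡ (Q.p₁∘universal P.commute))
             (≈-trans (P.p₁∘universal Q.commute) (≈-sym identityʳ)))
    (≈-trans (pullˡ (Q.p₂∘universal P.commute))
             (≈-trans (P.p₂∘universal Q.commute) (≈-sym identityʳ)))
    where
    module P = IsPullback isP
    module Q = IsPullback isQ

module LaterFibred {o ℓ e} (C : Category o ℓ e) (pb : HasPullbacks C)
       (▶ : Functor C C) (lex : PreservesFiniteLimits ▶) (next : NatTransFromId ▶) where
  open Category C
  open Functor ▶ renaming (F₁ to ▶₁)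
  open NatTransFromId next renaming (η to next₀; commute to next-commute)
  open PreservesFiniteLimits lex using (preserves-pullback)
  open LaterSlices pb ▶ next
  open PullbackFunctor C pb using (_*)
  open PullbackLemmas C
  open ArrHom using (top; bot)

  module ▶P (X : ArrObj) = Pullback (pb (next₀ (ArrObj.cod X)) (▶₁ (ArrObj.arr X)))

  ▶→₁-p₁ : ∀ {X Y} (f : ArrHom X Y) → ▶P.p₁ Y ∘ top (▶→₁ f) ≈ bot f ∘ ▶P.p₁ X
  ▶→₁-p₁ f = ArrHom.sq (▶→₁ f)

  ▶→₁-p₂ : ∀ {X Y} (f : ArrHom X Y) → ▶P.p₂ Y ∘ top (▶→₁ f) ≈ ▶₁ (top f) ∘ ▶P.p₂ X
  ▶→₁-p₂ {Y = Y} f = ▶P.p₂∘universal Y _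

  ▶→-identity : ∀ {X} → ▶→₁ (id→ {X}) ≈→ id→
  ▶→-identity {X} = pullback-ext (▶P.isPullback X)
    (≈-trans (▶→₁-p₁ id→) (≈-trans identityˡ (≈-sym identityʳ)))
    (≈-trans (▶→₁-p₂ id→) (≈-trans (∘-resp-≈ˡ identity) (≈-trans identityˡ (≈-sym identityʳ))))
    , ≈-refl

  ▶→-homomorphism : ∀ {X Y Z} {f : ArrHom X Y} {g : ArrHom Y Z} →
                    ▶→₁ (g ∘→ f) ≈→ (▶→₁ g ∘→ ▶→₁ f)
  ▶→-homomorphism {X} {Y} {Z} {f} {g} = pullback-ext (▶P.isPullback Z)
    (begin
      ▶P.p₁ Z ∘ top (▶→₁ (g ∘→ f))           ≈⟨ ▶→₁-p₁ (g ∘→ f) ⟩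
      (bot g ∘ bot f) ∘ ▶P.p₁ X              ≈⟨ assoc ⟩
      bot g ∘ (bot f ∘ ▶P.p₁ X)              ≈⟨ ∘-resp-≈ʳ (≈-sym (▶→₁-p₁ f)) ⟩
      bot g ∘ (▶P.p₁ Y ∘ top (▶→₁ f))        ≈⟨ pullˡ (≈-sym (▶→₁-p₁ g)) ⟩
      (▶P.p₁ Z ∘ top (▶→₁ g)) ∘ top (▶→₁ f)  ≈⟨ assoc ⟩
      ▶P.p₁ Z ∘ (top (▶→₁ g) ∘ top (▶→₁ f))  ∎)
    (begin
      ▶P.p₂ Z ∘ top (▶→₁ (g ∘→ f))           ≈⟨ ▶→₁-p₂ (g ∘→ f) ⟩
      ▶₁ (top g ∘ top f) ∘ ▶P.p₂ X           ≈⟨ ∘-resp-≈ˡ homomorphism ⟩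
      (▶₁ (top g) ∘ ▶₁ (top f)) ∘ ▶P.p₂ X    ≈⟨ assoc ⟩
      ▶₁ (top g) ∘ (▶₁ (top f) ∘ ▶P.p₂ X)    ≈⟨ ∘-resp-≈ʳ (≈-sym (▶→₁-p₂ f)) ⟩
      ▶₁ (top g) ∘ (▶P.p₂ Y ∘ top (▶→₁ f))   ≈⟨ pullˡ (≈-sym (▶→₁-p₂ g)) ⟩
      (▶P.p₂ Z ∘ top (▶→₁ g)) ∘ top (▶→₁ f)  ≈⟨ assoc ⟩
      ▶P.p₂ Z ∘ (top (▶→₁ g) ∘ top (▶→₁ f))  ∎)
    , ≈-refl

  ▶→-resp-≈ : ∀ {X Y} {f g : ArrHom X Y} → f ≈→ g → ▶→₁ f ≈→ ▶→₁ g
  ▶→-resp-≈ {Y = Y} {f} {g} (top≈ , bot≈) = pullback-ext (▶P.isPullback Y)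
    (≈-trans (▶→₁-p₁ f) (≈-trans (∘-resp-≈ˡ bot≈) (≈-sym (▶→₁-p₁ g))))
    (≈-trans (▶→₁-p₂ f) (≈-trans (∘-resp-≈ˡ (F-resp-≈ top≈)) (≈-sym (▶→₁-p₂ g))))
    , bot≈

  ▶→-preserves-cartesian : ∀ {X Y} (f : ArrHom X Y) → IsCartesian f → IsCartesian (▶→₁ f)
  ▶→-preserves-cartesian {X} {Y} f cart =
    Pasting.unpaste (▶P.isPullback Y) outer (≈-sym (▶→₁-p₁ f))
    where
    -- ▶_J X pasted with the ▶-image of the square is a pullback along
    -- ▶u ∘ next_J = next_I ∘ u
    outer : IsPullback C (next₀ (ArrObj.cod Y) ∘ bot f) (▶₁ (ArrObj.arr Y))
                         (▶P.p₁ X) (▶P.p₂ Y ∘ top (▶→₁ f))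
    outer = pullback-resp-≈
      (Pasting.paste (preserves-pullback cart) (▶P.isPullback X))
      (next-commute (bot f)) (≈-sym (▶→₁-p₂ f))

  ▶→-fibred : IsFibredEndofunctor
  ▶→-fibred = record
    { identity = ▶→-identity
    ; homomorphism = ▶→-homomorphism
    ; F-resp-≈ = ▶→-resp-≈
    ; preserves-cartesian = ▶→-preserves-cartesian
    }

  slice-arrow : ∀ {I} {X Y : SliceObj C I} → SliceHom C X Y →
                ArrHom (arrobj (SliceObj.arr X)) (arrobj (SliceObj.arr Y))
  slice-arrow f = arrhom (SliceHom.h f) id (≈-trans (SliceHom.△ f) (≈-sym identityˡ))

  -- ▶_I is the fibre of ▶→ over I
  ▶[]-is-fibre : ∀ {I} {X Y : SliceObj C I} (f : SliceHom C X Y) →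
                 SliceHom.h (FunctorData.F₁ ▶[ I ] f) ≈ top (▶→₁ (slice-arrow f))
  ▶[]-is-fibre {Y = Y} f = pullback-ext (▶P.isPullback Y′)
    (≈-trans (SliceHom.△ (FunctorData.F₁ ▶[ _ ] f))
             (≈-trans (≈-sym identityˡ) (≈-sym (▶→₁-p₁ (slice-arrow f)))))
    (≈-trans (▶P.p₂∘universal Y′ _) (≈-sym (▶→₁-p₂ (slice-arrow f))))
    where
    Y′ : ArrObj
    Y′ = arrobj (SliceObj.arr Y)

  module Reindexing {J I : Obj} (u : J ⇒ I) where
    u*₀ : SliceObj C I → SliceObj C J
    u*₀ = FunctorData.F₀ (u *)

    u*₁ : ∀ {X Y} → SliceHom C X Y → SliceHom C (u*₀ X) (u*₀ Y)
    u*₁ = FunctorData.F₁ (u *)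

    module R (Y : SliceObj C I) = Pullback (pb u (SliceObj.arr Y))

    reindex-arrow : ∀ Y → ArrHom (arrobj (SliceObj.arr (u*₀ Y))) (arrobj (SliceObj.arr Y))
    reindex-arrow Y = arrhom (R.p₂ Y) u (≈-sym (R.commute Y))

    reindex-arrow-natural : ∀ {X Y} (f : SliceHom C X Y) →
      (reindex-arrow Y ∘→ slice-arrow (u*₁ f)) ≈→ (slice-arrow f ∘→ reindex-arrow X)
    reindex-arrow-natural {Y = Y} f =
      R.p₂∘universal Y _ , ≈-trans identityʳ (≈-sym identityˡ)

    comparison : ∀ Y → ArrHom (▶→₀ (arrobj (SliceObj.arr (u*₀ Y)))) (▶→₀ (arrobj (SliceObj.arr Y)))
    comparison Y = ▶→₁ (reindex-arrow Y)

    comparison-cartesian : ∀ Y → IsCartesian (comparison Y)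
    comparison-cartesian Y = ▶→-preserves-cartesian (reindex-arrow Y) (R.isPullback Y)

    -- naturality of the comparison squares, by functoriality of ▶→
    comparison-natural : ∀ {X Y} (f : SliceHom C X Y) →
      top (comparison Y) ∘ SliceHom.h (FunctorData.F₁ ▶[ J ] (u*₁ f))
        ≈ SliceHom.h (FunctorData.F₁ ▶[ I ] f) ∘ top (comparison X)
    comparison-natural {X} {Y} f = begin
      top (comparison Y) ∘ SliceHom.h (FunctorData.F₁ ▶[ J ] (u*₁ f))
        ≈⟨ ∘-resp-≈ʳ (▶[]-is-fibre (u*₁ f)) ⟩
      top (▶→₁ (reindex-arrow Y) ∘→ ▶→₁ (slice-arrow (u*₁ f)))
        ≈⟨ ≈-sym (proj₁ ▶→-homomorphism) ⟩
      top (▶→₁ (reindex-arrow Y ∘→ slice-arrow (u*₁ f)))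
        ≈⟨ proj₁ (▶→-resp-≈ (reindex-arrow-natural f)) ⟩
      top (▶→₁ (slice-arrow f ∘→ reindex-arrow X))
        ≈⟨ proj₁ ▶→-homomorphism ⟩
      top (▶→₁ (slice-arrow f)) ∘ top (comparison X)
        ≈⟨ ∘-resp-≈ˡ (≈-sym (▶[]-is-fibre f)) ⟩
      SliceHom.h (FunctorData.F₁ ▶[ I ] f) ∘ top (comparison X) ∎

    -- u*(▶_I Y) and ▶_J(u*Y) are both pullbacks of J → I ← ▶_I Y, hence
    -- isomorphic over J via the comparison maps of the two pullbacks
    module Q (Y : SliceObj C I) = R (FunctorData.F₀ ▶[ I ] Y)
    module Cmp (Y : SliceObj C I) = IsPullback (comparison-cartesian Y)

    private
      module SJ = Category (Slice C J)
      F = (u *) ∘F ▶[ I ]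
      G = ▶[ J ] ∘F (u *)

    to : ∀ Y → SliceHom C (FunctorData.F₀ F Y) (FunctorData.F₀ G Y)
    to Y = slicehom (Cmp.universal Y (Q.commute Y)) (Cmp.p₁∘universal Y (Q.commute Y))

    from : ∀ Y → SliceHom C (FunctorData.F₀ G Y) (FunctorData.F₀ F Y)
    from Y = slicehom (Q.universal Y (Cmp.commute Y)) (Q.p₁∘universal Y (Cmp.commute Y))

    to-natural : ∀ {X Y} (f : SliceHom C X Y) →
                 FunctorData.F₁ G f SJ.∘ to X SJ.≈ to Y SJ.∘ FunctorData.F₁ F f
    to-natural {X} {Y} f = pullback-ext (comparison-cartesian Y)
      (≈-trans (SliceHom.△ (FunctorData.F₁ G f SJ.∘ to X))
               (≈-sym (SliceHom.△ (to Y SJ.∘ FunctorData.F₁ F f))))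
      (begin
        top (comparison Y) ∘ (SliceHom.h (FunctorData.F₁ G f) ∘ SliceHom.h (to X))
          ≈⟨ pullˡ (comparison-natural f) ⟩
        (SliceHom.h ▶f ∘ top (comparison X)) ∘ SliceHom.h (to X)
          ≈⟨ assoc ⟩
        SliceHom.h ▶f ∘ (top (comparison X) ∘ SliceHom.h (to X))
          ≈⟨ ∘-resp-≈ʳ (Cmp.p₂∘universal X (Q.commute X)) ⟩
        SliceHom.h ▶f ∘ Q.p₂ X
          ≈⟨ ≈-sym (Q.p₂∘universal Y _) ⟩
        Q.p₂ Y ∘ SliceHom.h (FunctorData.F₁ F f)
          ≈⟨ ∘-resp-≈ˡ (≈-sym (Cmp.p₂∘universal Y (Q.commute Y))) ⟩
        (top (comparison Y) ∘ SliceHom.h (to Y)) ∘ SliceHom.h (FunctorData.F₁ F f)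
          ≈⟨ assoc ⟩
        top (comparison Y) ∘ (SliceHom.h (to Y) ∘ SliceHom.h (FunctorData.F₁ F f)) ∎)
      where
      ▶f : SliceHom C (FunctorData.F₀ ▶[ I ] X) (FunctorData.F₀ ▶[ I ] Y)
      ▶f = FunctorData.F₁ ▶[ I ] f

    reindex-commutes : NaturalIsomorphism F G
    reindex-commutes = record
      { η = to
      ; η⁻¹ = from
      ; isoˡ = λ Y → comparison-inverse (comparison-cartesian Y) (Q.isPullback Y)
      ; isoʳ = λ Y → comparison-inverse (Q.isPullback Y) (comparison-cartesian Y)
      ; natural = to-natural
      }

-- Proposition 6.5.  Only the chosen pullbacks of the locally cartesian
-- closed structure and the lex functor ▶ with next : id → ▶ are used.
proposition6p5 : ∀ {o ℓ e} (E : Category o ℓ e) (lcc : LocallyCartesianClosed E)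
                   (M : ModelOfGuardedRecursiveTerms E) →
                 (∀ {J I : Category.Obj E} (u : Category._⇒_ E J I) →
                    NaturalIsomorphism
                      (PullbackFunctor._* E (LocallyCartesianClosed.pullbacks lcc) u
                        ∘F LaterSlices.▶[_] (LocallyCartesianClosed.pullbacks lcc)
                             (ModelOfGuardedRecursiveTerms.▶ M)
                             (ModelOfGuardedRecursiveTerms.next M) I)
                      (LaterSlices.▶[_] (LocallyCartesianClosed.pullbacks lcc)
                         (ModelOfGuardedRecursiveTerms.▶ M)
                         (ModelOfGuardedRecursiveTerms.next M) J
                        ∘F PullbackFunctor._* E (LocallyCartesianClosed.pullbacks lcc) u))
                 × LaterSlices.IsFibredEndofunctor (LocallyCartesianClosed.pullbacks lcc)
                     (ModelOfGuardedRecursiveTerms.▶ M) (ModelOfGuardedRecursiveTerms.next M)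
proposition6p5 E lcc M = (λ u → reindex-commutes u) , ▶→-fibred
  where
  open LaterFibred E (LocallyCartesianClosed.pullbacks lcc)
         (ModelOfGuardedRecursiveTerms.▶ M) (ModelOfGuardedRecursiveTerms.▶-lex M)
         (ModelOfGuardedRecursiveTerms.next M)
  open Reindexing using (reindex-commutes)
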